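{- Let $n$ be even and let $f$ be the standardly semilinear $n$-ary quasigroup of order $4$ defined by a Boolean function $\lambda:\mathbb{Z}_2^n\to\mathbb{Z}_2$. Then $f$ has no transversals if and only if for every brindled quadruple $\{z^1,z^2,z^3,z^4\}$ of Boolean $(n+1)$-vectors it holds $\lambda(\overline{z^1})\oplus\lambda(\overline{z^2})\oplus\lambda(\overline{z^3})\oplus\lambda(\overline{z^4})=1$.
   Context: Let $\Sigma_4=\{0,1,2,3\}$ and $l:\Sigma_4\to\mathbb{Z}_2$, $l(0)=l(1)=0$, $l(2)=l(3)=1$. The standardly semilinear $n$-ary quasigroup defined by $\lambda$ is the map $f:\Sigma_4^n\to\Sigma_4$ such that for all $x_0,\dots,x_n\in\Sigma_4$: $x_0=f(x_1,\dots,x_n)$ iff $l(x_0)+\dots+l(x_n)\equiv 0\pmod 2$ and $x_0+\dots+x_n+\lambda(l(x_1),\dots,l(x_n))\equiv 0\pmod 2$ (sums of integers). A transversal in $f$ is a set of $4$ vectors $\alpha^i=(a^i_0,\dots,a^i_n)\in\Sigma_4^{n+1}$ with $a^i_0=f(a^i_1,\dots,a^i_n)$ for all $i$ and $a^i_k\ne a^j_k$ for all $i\ne j$ and all $k$. The weight of a Boolean vector is the number of its coordinates equal to $1$. A quadruple is a multiset of four Boolean vectors; a quadruple $\{z^1,z^2,z^3,z^4\}$ of $(n+1)$-vectors $z^j=(z^j_0,\dots,z^j_n)$ is proper if for every $i\in\{0,\dots,n\}$ the multiset $\{z^1_i,z^2_i,z^3_i,z^4_i\}$ equals $\{0,0,1,1\}$;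 it is worthwhile if it is proper and every $z^j$ has even weight; it is brindled if it is worthwhile and the four vectors are pairwise distinct. For $z=(z_0,z_1,\dots,z_n)$ write $\overline{z}=(z_1,\dots,z_n)$; $\oplus$ is addition modulo $2$. -}

module Defs where

open import Data.Nat using (ℕ; suc; _+_; _%_)
open import Data.Bool using (Bool; true; false)
import Data.Bool as B
open import Data.Fin using (Fin; zero; suc; toℕ)
open import Data.Vec using (Vec; _∷_; []; map; sum; lookup; head; tail)
open import Data.Product using (_×_; ∃)
open import Relation.Binary.PropositionalEquality using (_≡_; _≢_)
open import Relation.Nullary using (¬_)

bit : Bool → ℕ
bit false = 0
bit true = 1

Σ₄ : Set
Σ₄ = Fin 4

-- l(0)=l(1)=0, l(2)=l(3)=1 (Z₂ represented by Bool, false = 0, true = 1)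
l : Σ₄ → Bool
l zero = false
l (suc zero) = false
l (suc (suc zero)) = true
l (suc (suc (suc zero))) = true

BoolFun : ℕ → Set
BoolFun n = Vec Bool n → Bool

-- The graph of the standardly semilinear n-ary quasigroup defined by λ:
-- (x₀,…,xₙ) satisfies x₀ = f(x₁,…,xₙ) iff
--   l(x₀)+…+l(xₙ) ≡ 0 (mod 2) and x₀+…+xₙ+λ(l(x₁),…,l(xₙ)) ≡ 0 (mod 2).
Graph : ∀ {n} → BoolFun n → Vec Σ₄ (suc n) → Set
Graph λf x =
  (sum (map (λ a → bit (l a)) x) % 2 ≡ 0) ×
  ((sum (map toℕ x) + bit (λf (map l (tail x)))) % 2 ≡ 0)

IsTransversal : ∀ {n} → BoolFun n → (Fin 4 → Vec Σ₄ (suc n)) → Set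
IsTransversal {n} λf α =
  (∀ i → Graph λf (α i)) ×
  (∀ i j → i ≢ j → ∀ (k : Fin (suc n)) → lookup (α i) k ≢ lookup (α j) k)

HasTransversal : ∀ {n} → BoolFun n → Set
HasTransversal λf = ∃ λ α → IsTransversal λf α

weight : ∀ {m} → Vec Bool m → ℕ
weight z = sum (map bit z)

-- A quadruple of Boolean (n+1)-vectors (multiset of four vectors; all notions
-- below are invariant under reordering).
Quadruple : ℕ → Set
Quadruple m = Fin 4 → Vec Bool m

countOnes : ∀ {m} → Quadruple m → Fin m → ℕ
countOnes z i =
  bit (lookup (z zero) i) + bit (lookup (z (suc zero)) i)
  + bit (lookup (z (suc (suc zero))) i)
  + bit (lookup (z (suc (suc (suc zero)))) i)

-- proper: every coordinate multiset is {0,0,1,1}, i.e. exactly two ones among four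
Proper : ∀ {m} → Quadruple m → Set
Proper z = ∀ i → countOnes z i ≡ 2

Worthwhile : ∀ {m} → Quadruple m → Set
Worthwhile z = Proper z × (∀ j → weight (z j) % 2 ≡ 0)

Brindled : ∀ {m} → Quadruple m → Set
Brindled z = Worthwhile z × (∀ i j → i ≢ j → z i ≢ z j)

bar : ∀ {n} → Vec Bool (suc n) → Vec Bool n
bar = tail

-- Write a ∈ Σ₄ as a = 2 l(a) + low(a). The columns of a transversal are permutations of
-- Σ₄, so its high parts z form a proper quadruple whose rows have even weight, and in
-- each column the low parts separate the two equal high entries; the graph condition
-- makes the low row of α^j have parity λ(z̄^j). Since every column of low parts contains
-- two ones, the four values λ(z̄^j) sum to 0; and for even n the quadruple is brindled,
-- because z^i = z^j would make two other rows complementary, of odd total weight n + 1.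
-- Conversely, the rows of a brindled z are distinct, so the pairings of equal entries
-- are not the same in all columns; scanning the columns one at a time shows that then
-- every even vector of row parities is attained by separating low parts.

module Submission where

open import Defs
open import Algebra using (CommutativeRing)
open import Data.Bool using (Bool; true; false; not; _xor_; if_then_else_)
import Data.Bool as Bool
open import Data.Bool.Properties
  using (not-involutive; not-distribˡ-xor; xor-assoc; xor-same; xor-identityʳ; ¬-not;
         xor-∧-commutativeRing)
open import Data.Fin using (Fin; zero; suc; toℕ)
import Data.Fin as Fin
open import Data.Fin.Properties using (all?; any?)
open import Data.Nat using (ℕ; zero; suc; _+_; _*_; _%_)
import Data.Nat as ℕ
open import Data.Nat.Divisibility using (_∣_; divides)
open import Data.Product using (∃; _×_; _,_; proj₁; proj₂)
open import Data.Sum using (_⊎_; inj₁; inj₂)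
open import Data.Vec using (Vec; []; _∷_; lookup; map; zipWith; tabulate; tail; replicate; sum)
open import Data.Vec.Properties
  using (lookup-map; lookup-zipWith; lookup-replicate; lookup∘tabulate; tabulate∘lookup;
         tabulate-cong; tabulate-∘; map-∘)
open import Data.Vec.Relation.Binary.Pointwise.Extensional using (ext; Pointwise-≡⇒≡)
open import Function using (_∘_)
open import Function.Bundles using (_⇔_; mk⇔; Equivalence)
open import Level using (0ℓ)
open import Relation.Binary.Definitions using (DecidableEquality)
open import Relation.Binary.PropositionalEquality
open import Relation.Nullary using (¬_; Dec; yes; no; ¬?; _×-dec_; _→-dec_; map′; does)
open import Relation.Nullary.Decidable using (from-yes)
open import Relation.Nullary.Negation using (contradiction)
open import Relation.Unary using (Pred; Decidable)
open import Algebra.Properties.CommutativeSemigroup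
  (CommutativeRing.+-commutativeSemigroup xor-∧-commutativeRing) using (interchange)

open Equivalence using (to; from)
open ≡-Reasoning

parity : ℕ → Bool
parity zero    = false
parity (suc n) = not (parity n)

parity-+ : ∀ m n → parity (m + n) ≡ parity m xor parity n
parity-+ zero    n = refl
parity-+ (suc m) n = trans (cong not (parity-+ m n)) (not-distribˡ-xor (parity m) (parity n))

parity-bit : ∀ b → parity (bit b) ≡ b
parity-bit false = refl
parity-bit true  = refl

parity-even : ∀ {n} → 2 ∣ n → parity n ≡ false
parity-even (divides q refl) = parity-*2 q
  where
  parity-*2 : ∀ q → parity (q * 2) ≡ false
  parity-*2 zero    = refl
  parity-*2 (suc q) = trans (not-involutive _) (parity-*2 q)

%2≡bit∘parity : ∀ n → n % 2 ≡ bit (parity n)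
%2≡bit∘parity zero          = refl
%2≡bit∘parity (suc zero)    = refl
%2≡bit∘parity (suc (suc n)) = trans (%2≡bit∘parity n) (cong bit (sym (not-involutive (parity n))))

%2≡0⇔parity≡false : ∀ n → n % 2 ≡ 0 ⇔ parity n ≡ false
%2≡0⇔parity≡false n = mk⇔
  (λ n%2≡0 → bit≡0 (trans (sym (%2≡bit∘parity n)) n%2≡0))
  (λ p≡false → trans (%2≡bit∘parity n) (cong bit p≡false))
  where
  bit≡0 : ∀ {b} → bit b ≡ 0 → b ≡ false
  bit≡0 {false} _ = refl

xor-cancelˡ : ∀ a b → a xor (a xor b) ≡ b
xor-cancelˡ a b = trans (sym (xor-assoc a a b)) (cong (_xor b) (xor-same a))

xor-cancelʳ : ∀ a b → (a xor b) xor b ≡ a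
xor-cancelʳ a b = trans (xor-assoc a b b) (trans (cong (a xor_) (xor-same b)) (xor-identityʳ a))

xor≡false⇔≡ : ∀ a b → a xor b ≡ false ⇔ a ≡ b
xor≡false⇔≡ a b = mk⇔
  (λ a⊕b≡false → trans (sym (xor-cancelʳ a b)) (cong (_xor b) a⊕b≡false))
  (λ { refl → xor-same a })

+bit-even⇔ : ∀ m b → (m + bit b) % 2 ≡ 0 ⇔ parity m ≡ b
+bit-even⇔ m b = mk⇔
  (λ even → to (xor≡false⇔≡ (parity m) b) (trans (sym parity-+bit) (to (%2≡0⇔parity≡false (m + bit b)) even)))
  (λ p≡b → from (%2≡0⇔parity≡false (m + bit b)) (trans parity-+bit (from (xor≡false⇔≡ (parity m) b) p≡b)))
  where
  parity-+bit : parity (m + bit b) ≡ parity m xor b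
  parity-+bit = trans (parity-+ m (bit b)) (cong (parity m xor_) (parity-bit b))

⨁ : ∀ {n} → Vec Bool n → Bool
⨁ []      = false
⨁ (b ∷ v) = b xor ⨁ v

Even : ∀ {n} → Vec Bool n → Set
Even v = ⨁ v ≡ false

infixr 5 _⊕_
_⊕_ : ∀ {n} → Vec Bool n → Vec Bool n → Vec Bool n
_⊕_ = zipWith _xor_

⨁-⊕ : ∀ {n} (u v : Vec Bool n) → ⨁ (u ⊕ v) ≡ ⨁ u xor ⨁ v
⨁-⊕ []      []      = refl
⨁-⊕ (a ∷ u) (b ∷ v) = trans (cong ((a xor b) xor_) (⨁-⊕ u v)) (interchange a b (⨁ u) (⨁ v))

⊕-even : ∀ {n} (u v : Vec Bool n) → Even u → Even v → Even (u ⊕ v)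
⊕-even u v eu ev = trans (⨁-⊕ u v) (cong₂ _xor_ eu ev)

⊕-self : ∀ {n} (v : Vec Bool n) → v ⊕ v ≡ replicate n false
⊕-self []      = refl
⊕-self (b ∷ v) = cong₂ _∷_ (xor-same b) (⊕-self v)

⨁-replicate-true : ∀ n → ⨁ (replicate n true) ≡ parity n
⨁-replicate-true zero    = refl
⨁-replicate-true (suc n) = cong not (⨁-replicate-true n)

⨁-tabulate-xor : ∀ {n} (f g : Fin n → Bool) →
  ⨁ (tabulate λ k → f k xor g k) ≡ ⨁ (tabulate f) xor ⨁ (tabulate g)
⨁-tabulate-xor {zero}  f g = refl
⨁-tabulate-xor {suc n} f g =
  trans (cong ((f zero xor g zero) xor_) (⨁-tabulate-xor (f ∘ suc) (g ∘ suc)))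
        (interchange (f zero) (g zero) _ _)

⨁-tabulate-false : ∀ {n} {f : Fin n → Bool} → (∀ k → f k ≡ false) → ⨁ (tabulate f) ≡ false
⨁-tabulate-false {zero}  _         = refl
⨁-tabulate-false {suc n} f≡false = cong₂ _xor_ (f≡false zero) (⨁-tabulate-false (f≡false ∘ suc))

parity-sum : ∀ {A : Set} {n} (f : A → ℕ) (v : Vec A n) → parity (sum (map f v)) ≡ ⨁ (map (parity ∘ f) v)
parity-sum f []      = refl
parity-sum f (a ∷ v) = trans (parity-+ (f a) _) (cong (parity (f a) xor_) (parity-sum f v))

parity-weight : ∀ {n} (v : Vec Bool n) → parity (weight v) ≡ ⨁ v
parity-weight []      = refl
parity-weight (b ∷ v) = trans (parity-+ (bit b) _) (cong₂ _xor_ (parity-bit b) (parity-weight v))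

even-weight⇔ : ∀ {n} (v : Vec Bool n) → weight v % 2 ≡ 0 ⇔ Even v
even-weight⇔ v = mk⇔
  (λ even → trans (sym (parity-weight v)) (to (%2≡0⇔parity≡false (weight v)) even))
  (λ ⨁≡false → from (%2≡0⇔parity≡false (weight v)) (trans (parity-weight v) ⨁≡false))

transpose : ∀ {A : Set} {r m} → (Fin r → Vec A m) → Fin m → Vec A r
transpose v k = tabulate λ i → lookup (v i) k

lookup-transpose : ∀ {A : Set} {r m} (v : Fin r → Vec A m) k i → lookup (transpose v k) i ≡ lookup (v i) k
lookup-transpose v k = lookup∘tabulate (λ i → lookup (v i) k)

transpose-map : ∀ {A B : Set} {r m} (f : A → B) (v : Fin r → Vec A m) k →
  transpose (λ i → map f (v i)) k ≡ map f (transpose v k)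
transpose-map f v k = trans (tabulate-cong λ i → lookup-map k f (v i)) (tabulate-∘ f λ i → lookup (v i) k)

⨁-transpose : ∀ {r m} (v : Fin r → Vec Bool m) → ⨁ (tabulate (⨁ ∘ v)) ≡ ⨁ (tabulate (⨁ ∘ transpose v))
⨁-transpose {zero} {m} v = sym (⨁-tabulate-false {m} λ _ → refl)
⨁-transpose {suc r} v = begin
  ⨁ (v zero) xor ⨁ (tabulate (⨁ ∘ v ∘ suc))
    ≡⟨ cong₂ _xor_ (cong ⨁ (sym (tabulate∘lookup (v zero)))) (⨁-transpose (v ∘ suc)) ⟩
  ⨁ (tabulate (lookup (v zero))) xor ⨁ (tabulate (⨁ ∘ transpose (v ∘ suc)))
    ≡⟨ sym (⨁-tabulate-xor (lookup (v zero)) (⨁ ∘ transpose (v ∘ suc))) ⟩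
  ⨁ (tabulate (⨁ ∘ transpose v)) ∎

-- Σ₄ as pairs of bits

low : Σ₄ → Bool
low a = parity (toℕ a)

-- The element 2h + q of Σ₄, so that l and low recover h and q.
enc : Bool → Bool → Σ₄
enc false false = zero
enc false true  = suc zero
enc true  false = suc (suc zero)
enc true  true  = suc (suc (suc zero))

map-l-enc : ∀ {n} (h q : Vec Bool n) → map l (zipWith enc h q) ≡ h
map-l-enc []      []      = refl
map-l-enc (false ∷ h) (false ∷ q) = cong (false ∷_) (map-l-enc h q)
map-l-enc (false ∷ h) (true  ∷ q) = cong (false ∷_) (map-l-enc h q)
map-l-enc (true  ∷ h) (false ∷ q) = cong (true ∷_) (map-l-enc h q)
map-l-enc (true  ∷ h) (true  ∷ q) = cong (true ∷_) (map-l-enc h q)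

map-low-enc : ∀ {n} (h q : Vec Bool n) → map low (zipWith enc h q) ≡ q
map-low-enc []      []      = refl
map-low-enc (false ∷ h) (false ∷ q) = cong (false ∷_) (map-low-enc h q)
map-low-enc (false ∷ h) (true  ∷ q) = cong (true ∷_) (map-low-enc h q)
map-low-enc (true  ∷ h) (false ∷ q) = cong (false ∷_) (map-low-enc h q)
map-low-enc (true  ∷ h) (true  ∷ q) = cong (true ∷_) (map-low-enc h q)

graph⇔ : ∀ {n} (λf : BoolFun n) (x : Vec Σ₄ (suc n)) →
  Graph λf x ⇔ (weight (map l x) % 2 ≡ 0 × ⨁ (map low x) ≡ λf (tail (map l x)))
graph⇔ λf (a ∷ x) = mk⇔
  (λ (l-even , sum-even) → subst (λ s → s % 2 ≡ 0) sums-l l-even ,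
                            trans (sym sums-low) (to sum-even⇔ sum-even))
  (λ (l-even , low≡λ) → subst (λ s → s % 2 ≡ 0) (sym sums-l) l-even ,
                         from sum-even⇔ (trans sums-low low≡λ))
  where
  sum-even⇔ : (sum (map toℕ (a ∷ x)) + bit (λf (map l x))) % 2 ≡ 0 ⇔ parity (sum (map toℕ (a ∷ x))) ≡ λf (map l x)
  sum-even⇔ = +bit-even⇔ (sum (map toℕ (a ∷ x))) (λf (map l x))
  sums-l : sum (map (λ a → bit (l a)) (a ∷ x)) ≡ weight (map l (a ∷ x))
  sums-l = cong sum (map-∘ bit l (a ∷ x))
  sums-low : parity (sum (map toℕ (a ∷ x))) ≡ ⨁ (map low (a ∷ x))
  sums-low = parity-sum toℕ (a ∷ x)

-- Single columns, checked exhaustively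

∀-Bool? : {P : Pred Bool 0ℓ} → Decidable P → Dec (∀ b → P b)
∀-Bool? P? = map′ (λ { (f , t) false → f ; (f , t) true → t }) (λ h → h false , h true)
                  (P? false ×-dec P? true)

∀-Vec? : {A : Set} → ({P : Pred A 0ℓ} → Decidable P → Dec (∀ a → P a)) →
         ∀ {n} {P : Pred (Vec A n) 0ℓ} → Decidable P → Dec (∀ v → P v)
∀-Vec? ∀? {zero}  P? = map′ (λ { h [] → h }) (λ h → h []) (P? [])
∀-Vec? ∀? {suc n} P? = map′ (λ { h (a ∷ v) → h a v }) (λ h a v → h (a ∷ v))
                            (∀? λ a → ∀-Vec? ∀? λ v → P? (a ∷ v))

Distinct : ∀ {A : Set} {n} → Vec A n → Set
Distinct y = ∀ i j → i ≢ j → lookup y i ≢ lookup y j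

distinct? : ∀ {n} (y : Vec Σ₄ n) → Dec (Distinct y)
distinct? y = all? λ i → all? λ j → ¬? (i Fin.≟ j) →-dec ¬? (lookup y i Fin.≟ lookup y j)

ones : Vec Bool 4 → ℕ
ones (a ∷ b ∷ c ∷ d ∷ []) = bit a + bit b + bit c + bit d

ProperColumn : Vec Bool 4 → Set
ProperColumn c = ones c ≡ 2

data Matching : Set where
  01∣23 02∣13 03∣12 : Matching

_≟ᴹ_ : DecidableEquality Matching
01∣23 ≟ᴹ 01∣23 = yes refl
01∣23 ≟ᴹ 02∣13 = no λ ()
01∣23 ≟ᴹ 03∣12 = no λ ()
02∣13 ≟ᴹ 01∣23 = no λ ()
02∣13 ≟ᴹ 02∣13 = yes refl
02∣13 ≟ᴹ 03∣12 = no λ ()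
03∣12 ≟ᴹ 01∣23 = no λ ()
03∣12 ≟ᴹ 02∣13 = no λ ()
03∣12 ≟ᴹ 03∣12 = yes refl

mate : Matching → Fin 4
mate 01∣23 = suc zero
mate 02∣13 = suc (suc zero)
mate 03∣12 = suc (suc (suc zero))

zero≢mate : ∀ M → zero ≢ mate M
zero≢mate 01∣23 ()
zero≢mate 02∣13 ()
zero≢mate 03∣12 ()

-- On a proper column, the matching whose blocks are the two level sets.
matching : Vec Bool 4 → Matching
matching (a ∷ b ∷ c ∷ _ ∷ []) with a Bool.≟ b | a Bool.≟ c
... | yes _ | _     = 01∣23
... | no _  | yes _ = 02∣13
... | no _  | no _  = 03∣12

pairParity : Matching → Vec Bool 4 → Bool
pairParity M t = lookup t zero xor lookup t (mate M)

pairParity-⊕ : ∀ M q t → pairParity M (q ⊕ t) ≡ pairParity M q xor pairParity M t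
pairParity-⊕ M q t = trans
  (cong₂ _xor_ (lookup-zipWith _xor_ zero q t) (lookup-zipWith _xor_ (mate M) q t))
  (interchange (lookup q zero) (lookup t zero) (lookup q (mate M)) (lookup t (mate M)))

-- q takes different values on both blocks of M (on the second one by evenness).
Separating : Matching → Vec Bool 4 → Set
Separating M q = Even q × pairParity M q ≡ true

separating? : ∀ M q → Dec (Separating M q)
separating? M q = (⨁ q Bool.≟ false) ×-dec (pairParity M q Bool.≟ true)

distinct-column : ∀ (x : Vec Σ₄ 4) → Distinct x → ProperColumn (map l x) × Even (map low x)
distinct-column = from-yes (∀-Vec? all? λ x →
  distinct? x →-dec (ones (map l x) ℕ.≟ 2) ×-dec (⨁ (map low x) Bool.≟ false))

separating-distinct : ∀ c q → ProperColumn c → Separating (matching c) q → Distinct (zipWith enc c q)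
separating-distinct = from-yes (∀-Vec? ∀-Bool? λ c → ∀-Vec? ∀-Bool? λ q →
  (ones c ℕ.≟ 2) →-dec separating? (matching c) q →-dec distinct? (zipWith enc c q))

proper-mate : ∀ c → ProperColumn c → lookup c zero ≡ lookup c (mate (matching c))
proper-mate = from-yes (∀-Vec? ∀-Bool? λ c →
  (ones c ℕ.≟ 2) →-dec (lookup c zero Bool.≟ lookup c (mate (matching c))))

proper-complement : ∀ c → ProperColumn c → ∀ i j k → i ≢ j → k ≢ i → k ≢ j →
  lookup c i ≡ lookup c j → lookup c i xor lookup c k ≡ true
proper-complement = from-yes (∀-Vec? ∀-Bool? λ c → (ones c ℕ.≟ 2) →-dec
  all? λ i → all? λ j → all? λ k → ¬? (i Fin.≟ j) →-dec ¬? (k Fin.≟ i) →-dec ¬? (k Fin.≟ j) →-dec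
  (lookup c i Bool.≟ lookup c j) →-dec (lookup c i xor lookup c k Bool.≟ true))

third : ∀ (i j : Fin 4) → ∃ λ k → k ≢ i × k ≢ j
third = from-yes (all? λ (i : Fin 4) → all? λ (j : Fin 4) → any? λ (k : Fin 4) → ¬? (k Fin.≟ i) ×-dec ¬? (k Fin.≟ j))

-- Separating low columns

standard : Matching → Vec Bool 4
standard 01∣23 = false ∷ true  ∷ false ∷ true ∷ []
standard 02∣13 = false ∷ false ∷ true  ∷ true ∷ []
standard 03∣12 = false ∷ false ∷ true  ∷ true ∷ []

standard-separating : ∀ M → Separating M (standard M)
standard-separating 01∣23 = refl , refl
standard-separating 02∣13 = refl , refl
standard-separating 03∣12 = refl , refl

-- Since M ≢ M′, the indices 0 and mate M′ lie in different blocks of M.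
separating-with : ∀ M M′ → M ≢ M′ → ∀ v → ∃ λ q → Separating M q × pairParity M′ q ≡ v
separating-with 01∣23 01∣23 M≢M′ _ = contradiction refl M≢M′
separating-with 02∣13 02∣13 M≢M′ _ = contradiction refl M≢M′
separating-with 03∣12 03∣12 M≢M′ _ = contradiction refl M≢M′
separating-with 01∣23 02∣13 _ false = false ∷ true  ∷ false ∷ true  ∷ [] , (refl , refl) , refl
separating-with 01∣23 02∣13 _ true  = false ∷ true  ∷ true  ∷ false ∷ [] , (refl , refl) , refl
separating-with 01∣23 03∣12 _ false = false ∷ true  ∷ true  ∷ false ∷ [] , (refl , refl) , refl
separating-with 01∣23 03∣12 _ true  = false ∷ true  ∷ false ∷ true  ∷ [] , (refl , refl) , refl
separating-with 02∣13 01∣23 _ false = false ∷ false ∷ true  ∷ true  ∷ [] , (refl , refl) , refl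
separating-with 02∣13 01∣23 _ true  = false ∷ true  ∷ true  ∷ false ∷ [] , (refl , refl) , refl
separating-with 02∣13 03∣12 _ false = false ∷ true  ∷ true  ∷ false ∷ [] , (refl , refl) , refl
separating-with 02∣13 03∣12 _ true  = false ∷ false ∷ true  ∷ true  ∷ [] , (refl , refl) , refl
separating-with 03∣12 01∣23 _ false = false ∷ false ∷ true  ∷ true  ∷ [] , (refl , refl) , refl
separating-with 03∣12 01∣23 _ true  = false ∷ true  ∷ false ∷ true  ∷ [] , (refl , refl) , refl
separating-with 03∣12 02∣13 _ false = false ∷ true  ∷ false ∷ true  ∷ [] , (refl , refl) , refl
separating-with 03∣12 02∣13 _ true  = false ∷ false ∷ true  ∷ true  ∷ [] , (refl , refl) , refl

-- uniform M b: every column has matching M, and b is the parity of their number.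
data Shape : Set where
  empty   : Shape
  uniform : Matching → Bool → Shape
  mixed   : Shape

step : Matching → Shape → Shape
step M empty          = uniform M true
step M (uniform M′ b) = if does (M ≟ᴹ M′) then uniform M (not b) else mixed
step M mixed          = mixed

shape : ∀ {m} → (Fin m → Matching) → Shape
shape {zero}  _  = empty
shape {suc m} ms = step (ms zero) (shape (ms ∘ suc))

Reachable : Shape → Vec Bool 4 → Set
Reachable empty         t = t ≡ replicate 4 false
Reachable (uniform M b) t = Even t × pairParity M t ≡ b
Reachable mixed         t = Even t

reachable-step : ∀ M s {t} → Reachable (step M s) t → ∃ λ q → Separating M q × Reachable s (q ⊕ t)
reachable-step M empty {t} separating = t , separating , ⊕-self t
reachable-step M mixed {t} even       = standard M , sep , ⊕-even (standard M) t (proj₁ sep) even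
  where
  sep : Separating M (standard M)
  sep = standard-separating M
reachable-step M (uniform M′ b) r with M ≟ᴹ M′
reachable-step M (uniform .M b) {t} (even , pp) | yes refl =
  standard M , sep , ⊕-even (standard M) t (proj₁ sep) even , (begin
    pairParity M (standard M ⊕ t)                ≡⟨ pairParity-⊕ M (standard M) t ⟩
    pairParity M (standard M) xor pairParity M t ≡⟨ cong₂ _xor_ (proj₂ sep) pp ⟩
    not (not b)                                  ≡⟨ not-involutive b ⟩
    b                                            ∎)
  where
  sep : Separating M (standard M)
  sep = standard-separating M
reachable-step M (uniform M′ b) {t} even | no M≢M′ =
  let q , sep , pp = separating-with M M′ M≢M′ (b xor pairParity M′ t) in
  q , sep , ⊕-even q t (proj₁ sep) even , (begin
    pairParity M′ (q ⊕ t)                       ≡⟨ pairParity-⊕ M′ q t ⟩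
    pairParity M′ q xor pairParity M′ t         ≡⟨ cong (_xor pairParity M′ t) pp ⟩
    (b xor pairParity M′ t) xor pairParity M′ t ≡⟨ xor-cancelʳ b (pairParity M′ t) ⟩
    b                                           ∎)

lowColumns : ∀ {m} (ms : Fin m → Matching) {t} → Reachable (shape ms) t →
  ∃ λ (qs : Fin m → Vec Bool 4) → (∀ k → Separating (ms k) (qs k)) × (∀ i → ⨁ (transpose qs i) ≡ lookup t i)
lowColumns {zero}  ms refl = (λ ()) , (λ ()) , λ i → sym (lookup-replicate i false)
lowColumns {suc m} ms {t} r =
  let q  , sep  , r′       = reachable-step (ms zero) (shape (ms ∘ suc)) r
      qs , seps , parities = lowColumns (ms ∘ suc) r′
  in (λ { zero → q ; (suc k) → qs k }) , (λ { zero → sep ; (suc k) → seps k }) , λ i → begin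
       lookup q i xor ⨁ (transpose qs i)          ≡⟨ cong (lookup q i xor_) (parities i) ⟩
       lookup q i xor lookup (q ⊕ t) i            ≡⟨ cong (lookup q i xor_) (lookup-zipWith _xor_ i q t) ⟩
       lookup q i xor (lookup q i xor lookup t i) ≡⟨ xor-cancelˡ (lookup q i) (lookup t i) ⟩
       lookup t i                                 ∎

step-nonempty : ∀ M s → step M s ≢ empty
step-nonempty M empty          ()
step-nonempty M mixed          ()
step-nonempty M (uniform M′ b) with M ≟ᴹ M′
... | yes _ = λ ()
... | no _  = λ ()

step-uniform : ∀ M s {M″ b} → step M s ≡ uniform M″ b →
  M ≡ M″ × (s ≡ empty ⊎ ∃ λ b′ → s ≡ uniform M″ b′)
step-uniform M empty          refl = refl , inj₁ refl
step-uniform M mixed          ()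
step-uniform M (uniform M′ b) e with M ≟ᴹ M′
step-uniform M (uniform .M b) refl | yes refl = refl , inj₂ (b , refl)
step-uniform M (uniform M′ b) ()   | no _

empty-shape : ∀ {m} (ms : Fin m → Matching) → shape ms ≡ empty → ¬ Fin m
empty-shape {suc m} ms e _ = step-nonempty (ms zero) (shape (ms ∘ suc)) e

shape-uniform : ∀ {m} (ms : Fin m → Matching) {M b} → shape ms ≡ uniform M b → ∀ k → ms k ≡ M
shape-uniform {suc m} ms e zero = proj₁ (step-uniform (ms zero) (shape (ms ∘ suc)) e)
shape-uniform {suc m} ms e (suc k) with step-uniform (ms zero) (shape (ms ∘ suc)) e
... | _ , inj₁ tail-empty          = contradiction k (empty-shape (ms ∘ suc) tail-empty)
... | _ , inj₂ (_ , tail-uniform) = shape-uniform (ms ∘ suc) tail-uniform k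

-- Transversals and brindled quadruples

brindled-mixed : ∀ {n} (z : Quadruple (suc n)) → Brindled z → shape (matching ∘ transpose z) ≡ mixed
brindled-mixed z ((proper , _) , distinct) with shape (matching ∘ transpose z) in e
... | empty       = contradiction zero (empty-shape (matching ∘ transpose z) e)
... | mixed       = refl
... | uniform M _ = contradiction (Pointwise-≡⇒≡ (ext z₀≡z-mate)) (distinct zero (mate M) (zero≢mate M))
  where
  z₀≡z-mate : ∀ k → lookup (z zero) k ≡ lookup (z (mate M)) k
  z₀≡z-mate k = begin
    lookup (transpose z k) zero                              ≡⟨ proper-mate (transpose z k) (proper k) ⟩
    lookup (transpose z k) (mate (matching (transpose z k))) ≡⟨ cong (lookup (transpose z k) ∘ mate) (shape-uniform (matching ∘ transpose z) e k) ⟩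
    lookup (transpose z k) (mate M)                          ≡⟨ lookup-transpose z k (mate M) ⟩
    lookup (z (mate M)) k                                    ∎

worthwhile-distinct : ∀ {n} → 2 ∣ n → (z : Quadruple (suc n)) → Worthwhile z → ∀ i j → i ≢ j → z i ≢ z j
worthwhile-distinct {n} 2∣n z (proper , weights) i j i≢j zi≡zj =
  contradiction (trans (cong not (sym (parity-even 2∣n))) parity-suc-n) λ ()
  where
  k : Fin 4
  k = proj₁ (third i j)
  k≢i : k ≢ i
  k≢i = proj₁ (proj₂ (third i j))
  k≢j : k ≢ j
  k≢j = proj₂ (proj₂ (third i j))
  even : ∀ j → Even (z j)
  even j = to (even-weight⇔ (z j)) (weights j)
  complementary : z i ⊕ z k ≡ replicate (suc n) true
  complementary = Pointwise-≡⇒≡ (ext complementary-at)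
    where
    complementary-at : ∀ q → lookup (z i ⊕ z k) q ≡ lookup (replicate (suc n) true) q
    complementary-at q = begin
      lookup (z i ⊕ z k) q                                  ≡⟨ lookup-zipWith _xor_ q (z i) (z k) ⟩
      lookup (z i) q xor lookup (z k) q                     ≡⟨ sym (cong₂ _xor_ (lookup-transpose z q i) (lookup-transpose z q k)) ⟩
      lookup (transpose z q) i xor lookup (transpose z q) k ≡⟨ proper-complement (transpose z q) (proper q) i j k i≢j k≢i k≢j ci≡cj ⟩
      true                                                  ≡⟨ sym (lookup-replicate q true) ⟩
      lookup (replicate (suc n) true) q                     ∎
      where
      ci≡cj : lookup (transpose z q) i ≡ lookup (transpose z q) j
      ci≡cj = begin
        lookup (transpose z q) i ≡⟨ lookup-transpose z q i ⟩
        lookup (z i) q           ≡⟨ cong (λ v → lookup v q) zi≡zj ⟩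
        lookup (z j) q           ≡⟨ sym (lookup-transpose z q j) ⟩
        lookup (transpose z q) j ∎
  parity-suc-n : parity (suc n) ≡ false
  parity-suc-n = begin
    parity (suc n)             ≡⟨ sym (⨁-replicate-true (suc n)) ⟩
    ⨁ (replicate (suc n) true) ≡⟨ cong ⨁ (sym complementary) ⟩
    ⨁ (z i ⊕ z k)              ≡⟨ ⊕-even (z i) (z k) (even i) (even k) ⟩
    false                      ∎

⨁λ : ∀ {n} → BoolFun n → Quadruple (suc n) → Bool
⨁λ λf z = λf (bar (z zero)) xor λf (bar (z (suc zero)))
          xor λf (bar (z (suc (suc zero)))) xor λf (bar (z (suc (suc (suc zero)))))

⨁λ≡⨁ : ∀ {n} (λf : BoolFun n) z → ⨁λ λf z ≡ ⨁ (tabulate λ i → λf (bar (z i)))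
⨁λ≡⨁ λf z = cong (λ x → λf (bar (z zero)) xor λf (bar (z (suc zero))) xor λf (bar (z (suc (suc zero)))) xor x)
                 (sym (xor-identityʳ _))

transversal⇒brindled : ∀ {n} → 2 ∣ n → (λf : BoolFun n) → HasTransversal λf →
  ∃ λ (z : Quadruple (suc n)) → Brindled z × ⨁λ λf z ≡ false
transversal⇒brindled 2∣n λf (α , graphs , distinct) =
  z , ((proper , weights) , worthwhile-distinct 2∣n z (proper , weights)) , ⨁λ≡false
  where
  z : Quadruple _
  z i = map l (α i)
  lows : Fin 4 → Vec Bool _
  lows i = map low (α i)
  column-distinct : ∀ k → Distinct (transpose α k)
  column-distinct k i j i≢j =
    subst₂ _≢_ (sym (lookup-transpose α k i)) (sym (lookup-transpose α k j)) (distinct i j i≢j k)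
  proper : Proper z
  proper k = subst ProperColumn (sym (transpose-map l α k)) (proj₁ (distinct-column _ (column-distinct k)))
  weights : ∀ j → weight (z j) % 2 ≡ 0
  weights j = proj₁ (to (graph⇔ λf (α j)) (graphs j))
  ⨁λ≡false : ⨁λ λf z ≡ false
  ⨁λ≡false = begin
    ⨁λ λf z                           ≡⟨ ⨁λ≡⨁ λf z ⟩
    ⨁ (tabulate λ i → λf (bar (z i))) ≡⟨ cong ⨁ (tabulate-cong λ i → sym (proj₂ (to (graph⇔ λf (α i)) (graphs i)))) ⟩
    ⨁ (tabulate (⨁ ∘ lows))           ≡⟨ ⨁-transpose lows ⟩
    ⨁ (tabulate (⨁ ∘ transpose lows)) ≡⟨ ⨁-tabulate-false (λ k → trans (cong ⨁ (transpose-map low α k))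
                                                                         (proj₂ (distinct-column _ (column-distinct k)))) ⟩
    false                             ∎

brindled⇒transversal : ∀ {n} (λf : BoolFun n) (z : Quadruple (suc n)) → Brindled z → ⨁λ λf z ≡ false →
  HasTransversal λf
brindled⇒transversal λf z brindled@((proper , weights) , _) ⨁λ≡false = α , graph , distinct
  where
  t : Vec Bool 4
  t = tabulate λ i → λf (bar (z i))
  reachable : Reachable (shape (matching ∘ transpose z)) t
  reachable = subst (λ s → Reachable s t) (sym (brindled-mixed z brindled)) (trans (sym (⨁λ≡⨁ λf z)) ⨁λ≡false)
  separated : ∃ λ (qs : Fin _ → Vec Bool 4) →
    (∀ k → Separating (matching (transpose z k)) (qs k)) × (∀ i → ⨁ (transpose qs i) ≡ lookup t i)
  separated = lowColumns (matching ∘ transpose z) reachable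
  qs : Fin _ → Vec Bool 4
  qs = proj₁ separated
  α : Fin 4 → Vec Σ₄ _
  α i = zipWith enc (z i) (transpose qs i)
  graph : ∀ i → Graph λf (α i)
  graph i = from (graph⇔ λf (α i)) (subst (λ v → weight v % 2 ≡ 0) (sym l-α) (weights i) , (begin
    ⨁ (map low (α i))       ≡⟨ cong ⨁ (map-low-enc (z i) (transpose qs i)) ⟩
    ⨁ (transpose qs i)      ≡⟨ proj₂ (proj₂ separated) i ⟩
    lookup t i              ≡⟨ lookup∘tabulate (λ i → λf (bar (z i))) i ⟩
    λf (bar (z i))          ≡⟨ cong (λf ∘ tail) (sym l-α) ⟩
    λf (tail (map l (α i))) ∎))
    where
    l-α : map l (α i) ≡ z i
    l-α = map-l-enc (z i) (transpose qs i)
  distinct : ∀ i j → i ≢ j → ∀ k → lookup (α i) k ≢ lookup (α j) k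
  distinct i j i≢j k = subst₂ _≢_ (entry i) (entry j)
    (separating-distinct (transpose z k) (qs k) (proper k) (proj₁ (proj₂ separated) k) i j i≢j)
    where
    entry : ∀ i → lookup (zipWith enc (transpose z k) (qs k)) i ≡ lookup (α i) k
    entry i = begin
      lookup (zipWith enc (transpose z k) (qs k)) i    ≡⟨ lookup-zipWith enc i (transpose z k) (qs k) ⟩
      enc (lookup (transpose z k) i) (lookup (qs k) i) ≡⟨ cong₂ enc (lookup-transpose z k i) (sym (lookup-transpose qs i k)) ⟩
      enc (lookup (z i) k) (lookup (transpose qs i) k) ≡⟨ sym (lookup-zipWith enc k (z i) (transpose qs i)) ⟩
      lookup (α i) k                                   ∎

proposition1 : (n : ℕ) → 2 ∣ n → (λf : BoolFun n) →
    (¬ HasTransversal λf) ⇔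
    ((z : Quadruple (suc n)) → Brindled z →
    (λf (bar (z zero)) xor λf (bar (z (suc zero)))
    xor λf (bar (z (suc (suc zero)))) xor λf (bar (z (suc (suc (suc zero)))))) ≡ true)
proposition1 n 2∣n λf = mk⇔
  (λ no-transversal z brindled →
     ¬-not λ ⨁λ≡false → no-transversal (brindled⇒transversal λf z brindled ⨁λ≡false))
  (λ all-odd transversal →
     let z , brindled , ⨁λ≡false = transversal⇒brindled 2∣n λf transversal
     in contradiction (trans (sym ⨁λ≡false) (all-odd z brindled)) λ ())
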